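{- Let $A$ be a finite abelian group of order $n$ and exponent greater than $2$, let $m$ be the number of elements of $A$ of order at most $2$, and let $\iota:A\to A$ be the automorphism $x\mapsto x^{ -1}$. Then the number of inverse-closed subsets $S\subseteq A$ such that $\varphi(S)=S$ for some $\varphi\in\Aut(A)\setminus\{1,\iota\}$ is at most $2^{m/2+11n/24+(\log_2 n)^2}$. -}

module Defs where

open import Data.Nat using (ℕ; suc; _+_; _*_; _^_; _<_; _≤_)
open import Data.Fin using (Fin; _≟_)
open import Data.Fin.Subset using (Subset; _∈_)
open import Data.List using (List; length; filter; allFin)
open import Data.List.Relation.Unary.All using (All)
open import Data.List.Relation.Unary.Unique.Propositional using (Unique)
open import Data.Product using (Σ; ∃; _×_; _,_)
open import Relation.Binary.PropositionalEquality using (_≡_)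
open import Relation.Nullary using (¬_)
open import Function.Definitions using (Bijective)
open import Algebra.Structures using (IsAbelianGroup)

-- A finite abelian group of order n, presented on the carrier Fin n
-- (every finite abelian group of order n is isomorphic to one of these),
-- with propositional equality.
record FinAbGroup (n : ℕ) : Set where
  field
    _∙_ : Fin n → Fin n → Fin n
    ε   : Fin n
    _⁻¹ : Fin n → Fin n
    isAbelianGroup : IsAbelianGroup _≡_ _∙_ ε _⁻¹

module _ {n : ℕ} (A : FinAbGroup n) where
  open FinAbGroup A

  ExponentGT2 : Set
  ExponentGT2 = ∃ λ x → ¬ (x ∙ x ≡ ε)

  numOrderLE2 : ℕ
  numOrderLE2 = length (filter (λ x → (x ∙ x) ≟ ε) (allFin n))

  IsAut : (Fin n → Fin n) → Set
  IsAut φ = Bijective _≡_ _≡_ φ × (∀ x y → φ (x ∙ y) ≡ φ x ∙ φ y)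

  IsNontrivialAut : (Fin n → Fin n) → Set
  IsNontrivialAut φ = IsAut φ × ¬ (∀ x → φ x ≡ x) × ¬ (∀ x → φ x ≡ x ⁻¹)

  InverseClosed : Subset n → Set
  InverseClosed S = ∀ x → x ∈ S → (x ⁻¹) ∈ S

  ImageEq : (Fin n → Fin n) → Subset n → Set
  ImageEq φ S = ∀ y → (y ∈ S → ∃ λ x → x ∈ S × φ x ≡ y)
                    × ((∃ λ x → x ∈ S × φ x ≡ y) → y ∈ S)

  Counted : Subset n → Set
  Counted S = InverseClosed S × (∃ λ φ → IsNontrivialAut φ × ImageEq φ S)

-- "c ≤ 2^(m/2 + 11n/24 + (log₂ n)²)" for natural numbers c, m, n ≥ 1,
-- expressed without reals.  Writing L = log₂ n ≥ 0, the bound is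
-- 24·log₂ c − 12m − 11n ≤ 24 L², which holds iff for every rational p/q > L
-- (i.e. n^q < 2^p, q ≥ 1) we have 24·log₂ c − 12m − 11n < 24 (p/q)²,
-- i.e. c^(24 q²) < 2^(12 m q² + 11 n q² + 24 p²).
BoundedBy : (c m n : ℕ) → Set
BoundedBy c m n = ∀ p q → 1 ≤ q → n ^ q < 2 ^ p →
  c ^ (24 * (q * q)) < 2 ^ (12 * m * (q * q) + 11 * n * (q * q) + 24 * (p * p))

module Submission where

open import Defs
open import Algebra.Bundles using (AbelianGroup)
open import Data.Bool using (true)
open import Data.Bool.Properties using (⇔→≡)
open import Data.Fin as Fin using (Fin; toℕ; fromℕ<; _≟_; combine; funToFin; finToFun)
open import Data.Fin.Induction using (<-wellFounded)
open import Data.Fin.Properties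
  using (any?; all?; ¬∀⟶∃¬; <-cmp; pigeonhole; toℕ<n; toℕ-fromℕ<; combine-injective;
         finToFun-funToFin; 2↔Bool)
open import Data.Fin.Subset using (Subset) renaming (_∈_ to _∈ₛ_)
open import Data.List as List using (List; []; _∷_; length; filter; allFin)
open import Data.List.Membership.Propositional using (_∈_; _─_)
open import Data.List.Membership.Propositional.Properties using (∈-filter⁺; ∈-filter⁻; ∈-allFin)
open import Data.List.Properties using (length-removeAt′; length-tabulate; length-filter; filter-≐)
open import Data.List.Relation.Unary.All as All using (All; []; _∷_)
open import Data.List.Relation.Unary.AllPairs using ([]; _∷_)
open import Data.List.Relation.Unary.Any using (here; there; index)
open import Data.List.Relation.Unary.Any.Properties using (lookup-index)
open import Data.List.Relation.Unary.Unique.Propositional using (Unique)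
import Data.List.Relation.Unary.Unique.Propositional.Properties as Unique
open import Data.Nat using (ℕ; zero; suc; _+_; _*_; _∸_; _^_; _≤_; _<_; z≤n; s≤s; >-nonZero)
open import Data.Nat.DivMod using (_%_; _/_; m%n<n; m≡m%n+[m/n]*n; m*n/n≡m; /-monoˡ-≤; m/n*n≤m)
open import Data.Nat.Properties
  using (+-suc; +-identityʳ; *-suc; *-comm; *-distribˡ-+; ≤-refl; ≤-trans; <⇒≤; <⇒≱; ≰⇒>; ≤-pred;
         n<1+n; m≤n+m; m+[n∸m]≡n; +-mono-≤; +-monoˡ-≤; +-monoʳ-≤; +-cancelʳ-≤;
         *-monoʳ-≤; *-monoˡ-≤; *-monoʳ-<; *-monoˡ-<;
         m^n>0; m^n≢0; ^-*-assoc; ^-distribˡ-+-*; ^-monoˡ-≤; ^-monoʳ-≤; ^-monoˡ-<; ^-monoʳ-<;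
         module ≤-Reasoning)
open import Data.Nat.Tactic.RingSolver using (solve-∀)
open import Data.Product using (∃; ∄-syntax; _×_; _,_; proj₁; proj₂; swap)
open import Data.Sum using (_⊎_; inj₁; inj₂; [_,_]) renaming (map to map-⊎)
open import Data.Vec using (lookup; tabulate)
open import Data.Vec.Properties using (lookup⇒[]=; []=⇒lookup; tabulate-cong; tabulate∘lookup)
open import Function using (_∘_; id; mk⇔; Inverse)
open import Function.Definitions using (Injective)
import Induction.WellFounded as WellFounded
open import Level using (0ℓ)
open import Relation.Binary using (tri<; tri≈; tri>)
open import Relation.Binary.PropositionalEquality
  using (_≡_; _≢_; _≗_; refl; sym; trans; cong; cong₂; subst; module ≡-Reasoning)
open import Relation.Nullary using (¬_; Dec; yes; no; ¬?; _×-dec_; _⊎-dec_; contradiction)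
open import Relation.Nullary.Decidable using (decidable-stable)
open import Relation.Unary using (Pred; Decidable; ∁; _∩_; _⊆_)
open import Relation.Unary.Properties using (∁?; _∩?_)

-- A counted set S is inverse-closed and φ-invariant for some automorphism φ ∉ {1, ι}, so it
-- is constant along the steps x ↦ x⁻¹, φ x, (φ x)⁻¹ and hence determined by φ together with
-- its values at the minimal elements: those with no smaller neighbour in this graph.  An
-- endomorphism is determined by its values on a generating set, and greedily adding elements
-- outside the generated subgroup doubles it each time, so some k generators with 2^k ≤ n
-- suffice.  The maps φ and ι send minimal elements to non-minimal ones, and the elements
-- that φ sends to neither x nor x⁻¹ make up at least a quarter of A, since they form the
-- complement of a union of two proper subgroups; counting with these injections gives at most
-- (12m + 11n)/24 minimal elements.  So there are at most n^k · 2^((12m + 11n)/24) counted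
-- sets, and n^k ≤ 2^((log₂ n)²).

n<2^n : ∀ n → n < 2 ^ n
n<2^n zero = s≤s z≤n
n<2^n (suc n) = +-mono-≤ (m^n>0 2 n) (subst (suc n ≤_) (sym (+-identityʳ (2 ^ n))) (n<2^n n))

^-distribʳ-* : ∀ a b e → (a * b) ^ e ≡ a ^ e * b ^ e
^-distribʳ-* a b zero = refl
^-distribʳ-* a b (suc e) = trans (cong (a * b *_) (^-distribʳ-* a b e)) (interchange a b (a ^ e) (b ^ e))
  where
  interchange : ∀ a b x y → a * b * (x * y) ≡ a * x * (b * y)
  interchange = solve-∀

n^kqq<2^pp : ∀ {n k p q} → 2 ^ k ≤ n → n ^ q < 2 ^ p → n ^ (k * q * q) < 2 ^ (p * p)
n^kqq<2^pp {n} {k} {p} {q} 2^k≤n n^q<2^p = begin-strict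
  n ^ (k * q * q)      ≡⟨ cong (n ^_) (reorder k q) ⟩
  n ^ (q * (k * q))    ≡⟨ ^-*-assoc n q (k * q) ⟨
  (n ^ q) ^ (k * q)    ≤⟨ ^-monoˡ-≤ (k * q) (<⇒≤ n^q<2^p) ⟩
  (2 ^ p) ^ (k * q)    ≡⟨ ^-*-assoc 2 p (k * q) ⟩
  2 ^ (p * (k * q))    <⟨ ^-monoʳ-< 2 (s≤s (s≤s z≤n)) (*-monoʳ-< p {{>-nonZero 0<p}} kq<p) ⟩
  2 ^ (p * p)          ∎
  where
  open ≤-Reasoning
  reorder : ∀ k q → k * q * q ≡ q * (k * q)
  reorder = solve-∀
  kq<p : k * q < p
  kq<p = ≰⇒> λ p≤kq → <⇒≱ (begin-strict
    2 ^ (k * q)  ≡⟨ ^-*-assoc 2 k q ⟨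
    (2 ^ k) ^ q  ≤⟨ ^-monoˡ-≤ q 2^k≤n ⟩
    n ^ q        <⟨ n^q<2^p ⟩
    2 ^ p        ∎) (^-monoʳ-≤ 2 p≤kq)
  0<p : 0 < p
  0<p = ≤-trans (s≤s z≤n) kq<p

≤n^k*2^r⇒BoundedBy : ∀ {c m n k r} → c ≤ n ^ k * 2 ^ r → 2 ^ k ≤ n → 24 * r ≤ 12 * m + 11 * n →
  BoundedBy c m n
≤n^k*2^r⇒BoundedBy {c} {m} {n} {k} {r} c≤n^k2^r 2^k≤n 24r≤12m+11n p q _ n^q<2^p = begin-strict
  c ^ (24 * (q * q))                                   ≤⟨ ^-monoˡ-≤ (24 * (q * q)) c≤n^k2^r ⟩
  (n ^ k * 2 ^ r) ^ (24 * (q * q))                     ≡⟨ ^-distribʳ-* (n ^ k) (2 ^ r) (24 * (q * q)) ⟩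
  (n ^ k) ^ (24 * (q * q)) * (2 ^ r) ^ (24 * (q * q))  ≡⟨ cong₂ _*_ n-part 2-part ⟩
  (n ^ (k * q * q)) ^ 24 * 2 ^ (24 * r * (q * q))      <⟨ *-monoˡ-< (2 ^ (24 * r * (q * q))) {{m^n≢0 2 (24 * r * (q * q))}}
                                                            (^-monoˡ-< 24 (n^kqq<2^pp {n} {k} {p} {q} 2^k≤n n^q<2^p)) ⟩
  (2 ^ (p * p)) ^ 24 * 2 ^ (24 * r * (q * q))
    ≤⟨ *-monoʳ-≤ ((2 ^ (p * p)) ^ 24) (^-monoʳ-≤ 2 (*-monoˡ-≤ (q * q) 24r≤12m+11n)) ⟩
  (2 ^ (p * p)) ^ 24 * 2 ^ ((12 * m + 11 * n) * (q * q))
    ≡⟨ cong (_* 2 ^ ((12 * m + 11 * n) * (q * q))) (^-*-assoc 2 (p * p) 24) ⟩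
  2 ^ (p * p * 24) * 2 ^ ((12 * m + 11 * n) * (q * q)) ≡⟨ ^-distribˡ-+-* 2 (p * p * 24) _ ⟨
  2 ^ (p * p * 24 + (12 * m + 11 * n) * (q * q))       ≡⟨ cong (2 ^_) (exponent p q m n) ⟩
  2 ^ (12 * m * (q * q) + 11 * n * (q * q) + 24 * (p * p)) ∎
  where
  open ≤-Reasoning
  n-part : (n ^ k) ^ (24 * (q * q)) ≡ (n ^ (k * q * q)) ^ 24
  n-part = trans (^-*-assoc n k (24 * (q * q))) (trans (cong (n ^_) (reorder k q)) (sym (^-*-assoc n (k * q * q) 24)))
    where
    reorder : ∀ k q → k * (24 * (q * q)) ≡ k * q * q * 24
    reorder = solve-∀
  2-part : (2 ^ r) ^ (24 * (q * q)) ≡ 2 ^ (24 * r * (q * q))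
  2-part = trans (^-*-assoc 2 r (24 * (q * q))) (cong (2 ^_) (reorder r q))
    where
    reorder : ∀ r q → r * (24 * (q * q)) ≡ 24 * r * (q * q)
    reorder = solve-∀
  exponent : ∀ p q m n → p * p * 24 + (12 * m + 11 * n) * (q * q) ≡ 12 * m * (q * q) + 11 * n * (q * q) + 24 * (p * p)
  exponent = solve-∀

minima-arithmetic : ∀ {x y m l n gₘ gₗ} → 2 * x + gₘ ≤ 2 * m → 6 * y + gₗ ≤ 3 * l → m + l ≡ n →
  n ≤ 4 * (gₘ + gₗ) → 24 * (x + y) ≤ 12 * m + 11 * n
minima-arithmetic {x} {y} {m} {l} {n} {gₘ} {gₗ} 2x+gₘ≤2m 6y+gₗ≤3l m+l≡n n≤4g =
  +-cancelʳ-≤ n (24 * (x + y)) (12 * m + 11 * n) (begin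
    24 * (x + y) + n                        ≤⟨ +-monoʳ-≤ (24 * (x + y)) n≤12gₘ+4gₗ ⟩
    24 * (x + y) + (12 * gₘ + 4 * gₗ)       ≡⟨ regroupˡ x y gₘ gₗ ⟩
    12 * (2 * x + gₘ) + 4 * (6 * y + gₗ)    ≤⟨ +-mono-≤ (*-monoʳ-≤ 12 2x+gₘ≤2m) (*-monoʳ-≤ 4 6y+gₗ≤3l) ⟩
    12 * (2 * m) + 4 * (3 * l)              ≡⟨ regroupʳ m l ⟩
    12 * m + 12 * (m + l)                   ≡⟨ cong (λ k → 12 * m + 12 * k) m+l≡n ⟩
    12 * m + 12 * n                         ≡⟨ split-12n m n ⟩
    12 * m + 11 * n + n                     ∎)
  where
  open ≤-Reasoning
  n≤12gₘ+4gₗ : n ≤ 12 * gₘ + 4 * gₗ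
  n≤12gₘ+4gₗ = ≤-trans n≤4g (subst (_≤ 12 * gₘ + 4 * gₗ) (sym (*-distribˡ-+ 4 gₘ gₗ))
    (+-monoˡ-≤ (4 * gₗ) (*-monoˡ-≤ gₘ {4} {12} (s≤s (s≤s (s≤s (s≤s z≤n)))))))
  regroupˡ : ∀ x y gₘ gₗ → 24 * (x + y) + (12 * gₘ + 4 * gₗ) ≡ 12 * (2 * x + gₘ) + 4 * (6 * y + gₗ)
  regroupˡ = solve-∀
  regroupʳ : ∀ m l → 12 * (2 * m) + 4 * (3 * l) ≡ 12 * m + 12 * (m + l)
  regroupʳ = solve-∀
  split-12n : ∀ m n → 12 * m + 12 * n ≡ 12 * m + 11 * n + n
  split-12n = solve-∀

∄-difference⇒⊆ : ∀ {A : Set} {P Q : Pred A 0ℓ} → Decidable P → ¬ ∃ (Q ∩ ∁ P) → Q ⊆ P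
∄-difference⇒⊆ P? Q∖P≡∅ {x} x∈Q = decidable-stable (P? x) λ x∉P → Q∖P≡∅ (x , x∈Q , x∉P)

module _ {A B : Set} where

  ∈-─⁺ : ∀ {x y : B} (ys : List B) (x∈ys : x ∈ ys) → y ∈ ys → y ≢ x → y ∈ ys ─ x∈ys
  ∈-─⁺ (_ ∷ _) (here refl) (here refl) y≢x = contradiction refl y≢x
  ∈-─⁺ (_ ∷ _) (here refl) (there y∈ys) _ = y∈ys
  ∈-─⁺ (_ ∷ _) (there _) (here refl) _ = here refl
  ∈-─⁺ (_ ∷ _) (there x∈ys) (there y∈ys) y≢x = there (∈-─⁺ _ x∈ys y∈ys y≢x)

  length-≤-of-injection : ∀ {xs : List A} (ys : List B) → Unique xs →
    (f : ∀ {x} → x ∈ xs → B) → (∀ {x} (x∈xs : x ∈ xs) → f x∈xs ∈ ys) →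
    (∀ {x y} (x∈xs : x ∈ xs) (y∈xs : y ∈ xs) → f x∈xs ≡ f y∈xs → x ≡ y) →
    length xs ≤ length ys
  length-≤-of-injection {[]} _ _ _ _ _ = z≤n
  length-≤-of-injection {x ∷ xs} ys (x∉xs ∷ xs!) f f∈ys f-inj =
    subst (suc (length xs) ≤_) (sym (length-removeAt′ ys _))
      (s≤s (length-≤-of-injection (ys ─ fx∈ys) xs! (f ∘ there)
        (λ y∈xs → ∈-─⁺ ys fx∈ys (f∈ys (there y∈xs)) (λ fy≡fx →
          All.lookup x∉xs y∈xs (f-inj (here refl) (there y∈xs) (sym fy≡fx))))
        (λ x∈xs y∈xs → f-inj (there x∈xs) (there y∈xs))))
    where fx∈ys = f∈ys (here refl)

funToFin-injective : ∀ {m n} {f g : Fin m → Fin n} → funToFin f ≡ funToFin g → f ≗ g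
funToFin-injective {f = f} {g} f≡g i =
  trans (sym (finToFun-funToFin f i)) (trans (cong (λ c → finToFun c i) f≡g) (finToFun-funToFin g i))

2↔Bool-from-injective : Injective _≡_ _≡_ (Inverse.from 2↔Bool)
2↔Bool-from-injective {a} {b} bit-a≡bit-b = trans (sym (Inverse.strictlyInverseˡ 2↔Bool a))
  (trans (cong (Inverse.to 2↔Bool) bit-a≡bit-b) (Inverse.strictlyInverseˡ 2↔Bool b))

lookupOr : {X : Set} → X → List X → ℕ → X
lookupOr d [] _ = d
lookupOr d (x ∷ xs) zero = x
lookupOr d (x ∷ xs) (suc i) = lookupOr d xs i

lookupOr-index : ∀ {X : Set} {d x : X} {xs} (x∈xs : x ∈ xs) → lookupOr d xs (toℕ (index x∈xs)) ≡ x
lookupOr-index (here refl) = refl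
lookupOr-index (there x∈xs) = lookupOr-index x∈xs

⇔⇒lookup-≡ : ∀ {n} {S : Subset n} {x y} → (x ∈ₛ S → y ∈ₛ S) → (y ∈ₛ S → x ∈ₛ S) →
  lookup S x ≡ lookup S y
⇔⇒lookup-≡ {S = S} {x} {y} x∈⇒y∈ y∈⇒x∈ = ⇔→≡ {z = true} (mk⇔
  (λ Sx≡true → []=⇒lookup (x∈⇒y∈ (lookup⇒[]= x S Sx≡true)))
  (λ Sy≡true → []=⇒lookup (y∈⇒x∈ (lookup⇒[]= y S Sy≡true))))


module _ {n : ℕ} where

  count : {P : Pred (Fin n) 0ℓ} → Decidable P → ℕ
  count P? = length (filter P? (allFin n))

  count-injection : ∀ {P Q : Pred (Fin n) 0ℓ} (P? : Decidable P) (Q? : Decidable Q)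
    (f : Fin n → Fin n) → Injective _≡_ _≡_ f → (∀ {x} → P x → Q (f x)) → count P? ≤ count Q?
  count-injection P? Q? f f-inj PQ = length-≤-of-injection _ (Unique.filter⁺ P? (Unique.allFin⁺ n))
    (λ {x} _ → f x)
    (λ {x} x∈ → ∈-filter⁺ Q? (∈-allFin (f x)) (PQ (proj₂ (∈-filter⁻ P? {xs = allFin n} x∈))))
    (λ _ _ → f-inj)

  count-mono : ∀ {P Q : Pred (Fin n) 0ℓ} (P? : Decidable P) (Q? : Decidable Q) → P ⊆ Q → count P? ≤ count Q?
  count-mono P? Q? P⊆Q = count-injection P? Q? id id P⊆Q

  count-≤ : ∀ {P : Pred (Fin n) 0ℓ} (P? : Decidable P) → count P? ≤ n
  count-≤ P? = subst (count P? ≤_) (length-tabulate id) (length-filter P? (allFin n))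

  count>0 : ∀ {P : Pred (Fin n) 0ℓ} (P? : Decidable P) {x} → P x → 0 < count P?
  count>0 P? {x} Px with filter P? (allFin n) | ∈-filter⁺ P? (∈-allFin x) Px
  ... | _ ∷ _ | _ = s≤s z≤n

  count-split : ∀ {P Q : Pred (Fin n) 0ℓ} (P? : Decidable P) (Q? : Decidable Q) →
    count P? ≡ count (P? ∩? Q?) + count (P? ∩? ∁? Q?)
  count-split P? Q? = split (allFin n)
    where
    split : ∀ xs → length (filter P? xs) ≡ length (filter (P? ∩? Q?) xs) + length (filter (P? ∩? ∁? Q?) xs)
    split [] = refl
    split (x ∷ xs) with P? x | Q? x
    ... | yes _ | yes _ = cong suc (split xs)
    ... | yes _ | no _ = trans (cong suc (split xs)) (sym (+-suc _ _))
    ... | no _ | _ = split xs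

  count-complement : ∀ {P : Pred (Fin n) 0ℓ} (P? : Decidable P) → count P? + count (∁? P?) ≡ n
  count-complement P? = trans (complement (allFin n)) (length-tabulate id)
    where
    complement : ∀ xs → length (filter P? xs) + length (filter (∁? P?) xs) ≡ length xs
    complement [] = refl
    complement (x ∷ xs) with P? x
    ... | yes _ = cong suc (complement xs)
    ... | no _ = trans (+-suc _ _) (cong suc (complement xs))

module FinAbGroupProperties {n : ℕ} (A : FinAbGroup n) where

  open FinAbGroup A public renaming (_∙_ to infixl 7 _∙_; _⁻¹ to infix 9 _⁻¹)

  abelianGroup : AbelianGroup 0ℓ 0ℓ
  abelianGroup = record { isAbelianGroup = isAbelianGroup }

  open AbelianGroup abelianGroup public
    using (identityˡ; identityʳ; inverseʳ; monoid; commutativeSemigroup)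
  open import Algebra.Properties.AbelianGroup abelianGroup public
    using (∙-cancelˡ; ∙-cancelʳ; ⁻¹-involutive; ⁻¹-injective; ⁻¹-∙-comm; inverseʳ-unique; ε⁻¹≈ε;
           \\-leftDividesʳ; //-rightDividesʳ)
  open import Algebra.Properties.CommutativeSemigroup commutativeSemigroup public using (interchange)

  open import Algebra.Properties.Monoid.Mult monoid using (×-homo-+; ×-assocˡ) renaming (_×_ to infixr 8 _·_)

  IsEndomorphism : (Fin n → Fin n) → Set
  IsEndomorphism φ = ∀ x y → φ (x ∙ y) ≡ φ x ∙ φ y

  module Endomorphism {φ : Fin n → Fin n} (φ-∙ : IsEndomorphism φ) where

    φ-ε : φ ε ≡ ε
    φ-ε = ∙-cancelˡ (φ ε) (φ ε) ε (begin
      φ ε ∙ φ ε  ≡⟨ φ-∙ ε ε ⟨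
      φ (ε ∙ ε)  ≡⟨ cong φ (identityˡ ε) ⟩
      φ ε        ≡⟨ identityʳ (φ ε) ⟨
      φ ε ∙ ε    ∎)
      where open ≡-Reasoning

    φ-⁻¹ : ∀ x → φ (x ⁻¹) ≡ φ x ⁻¹
    φ-⁻¹ x = inverseʳ-unique (φ x) (φ (x ⁻¹))
      (trans (sym (φ-∙ x (x ⁻¹))) (trans (cong φ (inverseʳ x)) φ-ε))

    φ-· : ∀ k x → φ (k · x) ≡ k · φ x
    φ-· zero x = φ-ε
    φ-· (suc k) x = trans (φ-∙ x (k · x)) (cong (φ x ∙_) (φ-· k x))

  record IsSubgroup (H : Pred (Fin n) 0ℓ) : Set where
    field
      ∙-closed : ∀ {x y} → H x → H y → H (x ∙ y)
      ⁻¹-closed : ∀ {x} → H x → H (x ⁻¹)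

    ∉-∙-∈ : ∀ {g x} → ¬ H g → H x → ¬ H (g ∙ x)
    ∉-∙-∈ {g} {x} g∉H x∈H gx∈H = g∉H (subst H (//-rightDividesʳ x g) (∙-closed gx∈H (⁻¹-closed x∈H)))

    ⁻¹-∉ : ∀ {x} → ¬ H x → ¬ H (x ⁻¹)
    ⁻¹-∉ {x} x∉H x⁻¹∈H = x∉H (subst H (⁻¹-involutive x) (⁻¹-closed x⁻¹∈H))

    ∈-∙-∉ : ∀ {g x} → H g → ¬ H x → ¬ H (g ∙ x)
    ∈-∙-∉ {g} {x} g∈H x∉H gx∈H = x∉H (subst H (\\-leftDividesʳ g x) (∙-closed (⁻¹-closed g∈H) gx∈H))

  open IsSubgroup

  Order≤2 : Pred (Fin n) 0ℓ
  Order≤2 x = x ∙ x ≡ ε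

  Order≤2? : Decidable Order≤2
  Order≤2? x = x ∙ x ≟ ε

  Order>2? : Decidable (∁ Order≤2)
  Order>2? = ∁? Order≤2?

  Order≤2-isSubgroup : IsSubgroup Order≤2
  Order≤2-isSubgroup = record
    { ∙-closed = λ {x} {y} x²≡ε y²≡ε → begin
        x ∙ y ∙ (x ∙ y)   ≡⟨ interchange x y x y ⟩
        x ∙ x ∙ (y ∙ y)   ≡⟨ cong₂ _∙_ x²≡ε y²≡ε ⟩
        ε ∙ ε             ≡⟨ identityˡ ε ⟩
        ε                 ∎
    ; ⁻¹-closed = λ {x} x²≡ε → begin
        x ⁻¹ ∙ x ⁻¹       ≡⟨ ⁻¹-∙-comm x x ⟩
        (x ∙ x) ⁻¹        ≡⟨ cong _⁻¹ x²≡ε ⟩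
        ε ⁻¹              ≡⟨ ε⁻¹≈ε ⟩
        ε                 ∎
    }
    where open ≡-Reasoning

  count-translation : ∀ {P Q : Pred (Fin n) 0ℓ} (P? : Decidable P) (Q? : Decidable Q) (a : Fin n) →
    (∀ {x} → P x → Q (a ∙ x)) → count P? ≤ count Q?
  count-translation P? Q? a = count-injection P? Q? (a ∙_) (∙-cancelˡ a _ _)

  count-difference≤count-outside : ∀ {H K : Pred (Fin n) 0ℓ} (H? : Decidable H) (K? : Decidable K) →
    IsSubgroup H → IsSubgroup K → ∀ {g} → ¬ H g → count (H? ∩? ∁? K?) ≤ count (∁? H? ∩? ∁? K?)
  count-difference≤count-outside H? K? H≤A K≤A {g} g∉H with any? (K? ∩? ∁? H?)
  ... | yes (b , b∈K , b∉H) = count-translation (H? ∩? ∁? K?) (∁? H? ∩? ∁? K?) b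
          λ (x∈H , x∉K) → ∉-∙-∈ H≤A b∉H x∈H , ∈-∙-∉ K≤A b∈K x∉K
  ... | no K∖H≡∅ = count-translation (H? ∩? ∁? K?) (∁? H? ∩? ∁? K?) g
          λ (x∈H , _) → let gx∉H = ∉-∙-∈ H≤A g∉H x∈H in gx∉H , gx∉H ∘ ∄-difference⇒⊆ H? K∖H≡∅

  n≤4*count-outside : ∀ {H K : Pred (Fin n) 0ℓ} (H? : Decidable H) (K? : Decidable K) →
    IsSubgroup H → IsSubgroup K → ∀ {g h} → ¬ H g → ¬ K h → n ≤ 4 * count (∁? H? ∩? ∁? K?)
  n≤4*count-outside H? K? H≤A K≤A {g} {h} g∉H h∉K = begin
    n                                     ≡⟨ partition ⟩
    (count (H? ∩? K?) + count (H? ∩? ∁? K?)) + (count (∁? H? ∩? K?) + b)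
      ≤⟨ +-mono-≤ (+-mono-≤ H∩K≤b H∖K≤b) (+-mono-≤ K∖H≤b ≤-refl) ⟩
    (b + b) + (b + b)                     ≡⟨ four-times b ⟩
    4 * b                                 ∎
    where
    open ≤-Reasoning
    b = count (∁? H? ∩? ∁? K?)
    partition : n ≡ (count (H? ∩? K?) + count (H? ∩? ∁? K?)) + (count (∁? H? ∩? K?) + b)
    partition = trans (sym (count-complement H?)) (cong₂ _+_ (count-split H? K?) (count-split (∁? H?) K?))
    four-times : ∀ b → (b + b) + (b + b) ≡ 4 * b
    four-times = solve-∀
    H∖K≤b : count (H? ∩? ∁? K?) ≤ b
    H∖K≤b = count-difference≤count-outside H? K? H≤A K≤A g∉H
    K∖H≤b : count (∁? H? ∩? K?) ≤ b
    K∖H≤b = ≤-trans (count-mono (∁? H? ∩? K?) (K? ∩? ∁? H?) swap)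
              (≤-trans (count-difference≤count-outside K? H? K≤A H≤A h∉K)
                (count-mono (∁? K? ∩? ∁? H?) (∁? H? ∩? ∁? K?) swap))
    H∩K≤b : count (H? ∩? K?) ≤ b
    H∩K≤b with any? (H? ∩? ∁? K?)
    ... | yes (a , a∈H , a∉K) = ≤-trans (count-translation (H? ∩? K?) (H? ∩? ∁? K?) a
            λ (x∈H , x∈K) → ∙-closed H≤A a∈H x∈H , ∉-∙-∈ K≤A a∉K x∈K) H∖K≤b
    ... | no H∖K≡∅ = count-translation (H? ∩? K?) (∁? H? ∩? ∁? K?) h
            λ (_ , x∈K) → let hx∉K = ∉-∙-∈ K≤A h∉K x∈K in hx∉K ∘ ∄-difference⇒⊆ K? H∖K≡∅ , hx∉K

  ·-ε : ∀ k → k · ε ≡ ε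
  ·-ε zero = refl
  ·-ε (suc k) = trans (identityˡ (k · ε)) (·-ε k)

  bounded-order : ∀ g → ∃ λ d → suc d ≤ n × suc d · g ≡ ε
  bounded-order g with pigeonhole (n<1+n n) (λ (i : Fin (suc n)) → toℕ i · g)
  ... | i , j , i<j , iᵍ≡jᵍ = d , d<n , ∙-cancelˡ (toℕ i · g) (suc d · g) ε (begin
    toℕ i · g ∙ suc d · g   ≡⟨ ×-homo-+ g (toℕ i) (suc d) ⟨
    (toℕ i + suc d) · g     ≡⟨ cong (_· g) i+d≡j ⟩
    toℕ j · g               ≡⟨ iᵍ≡jᵍ ⟨
    toℕ i · g               ≡⟨ identityʳ (toℕ i · g) ⟨
    toℕ i · g ∙ ε           ∎)
    where
    open ≡-Reasoning
    d = toℕ j ∸ suc (toℕ i)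
    i+d≡j : toℕ i + suc d ≡ toℕ j
    i+d≡j = trans (+-suc (toℕ i) d) (m+[n∸m]≡n i<j)
    d<n : suc d ≤ n
    d<n = ≤-trans (m≤n+m (suc d) (toℕ i)) (subst (_≤ n) (sym i+d≡j) (≤-pred (toℕ<n j)))

  Fin-power : ∀ g a → ∃ λ (j : Fin n) → toℕ j · g ≡ a · g
  Fin-power g a with bounded-order g
  ... | d , d<n , ord = fromℕ< a%d<n , (begin
    toℕ (fromℕ< a%d<n) · g                      ≡⟨ cong (_· g) (toℕ-fromℕ< a%d<n) ⟩
    (a % suc d) · g                             ≡⟨ identityʳ _ ⟨
    (a % suc d) · g ∙ ε                         ≡⟨ cong (λ z → (a % suc d) · g ∙ z) (·-ε (a / suc d)) ⟨
    (a % suc d) · g ∙ (a / suc d) · ε           ≡⟨ cong (λ z → (a % suc d) · g ∙ (a / suc d) · z) ord ⟨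
    (a % suc d) · g ∙ (a / suc d) · suc d · g   ≡⟨ cong ((a % suc d) · g ∙_) (×-assocˡ g (a / suc d) (suc d)) ⟩
    (a % suc d) · g ∙ (a / suc d * suc d) · g   ≡⟨ ×-homo-+ g (a % suc d) (a / suc d * suc d) ⟨
    (a % suc d + a / suc d * suc d) · g         ≡⟨ cong (_· g) (m≡m%n+[m/n]*n a (suc d)) ⟨
    a · g                                       ∎)
    where
    open ≡-Reasoning
    a%d<n = ≤-trans (m%n<n a (suc d)) d<n

  Fin-power-⁻¹ : ∀ g a → ∃ λ (j : Fin n) → toℕ j · g ≡ (a · g) ⁻¹
  Fin-power-⁻¹ g a with bounded-order g
  ... | d , _ , ord with Fin-power g (a * d)
  ... | j , jᵍ≡ = j , trans jᵍ≡ (inverseʳ-unique (a · g) ((a * d) · g) (begin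
    a · g ∙ (a * d) · g   ≡⟨ ×-homo-+ g a (a * d) ⟨
    (a + a * d) · g       ≡⟨ cong (_· g) (*-suc a d) ⟨
    (a * suc d) · g       ≡⟨ ×-assocˡ g a (suc d) ⟨
    a · suc d · g         ≡⟨ cong (a ·_) ord ⟩
    a · ε                 ≡⟨ ·-ε a ⟩
    ε                     ∎))
    where open ≡-Reasoning

  -- The subgroup generated by gs; exponents range over Fin n (enough by bounded-order) to keep it decidable.
  Span : List (Fin n) → Pred (Fin n) 0ℓ
  Span [] x = x ≡ ε
  Span (g ∷ gs) x = ∃ λ (j : Fin n) → Span gs (x ∙ toℕ j · g)

  Span? : ∀ gs → Decidable (Span gs)
  Span? [] x = x ≟ ε
  Span? (g ∷ gs) x = any? (λ j → Span? gs (x ∙ toℕ j · g))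

  ε∈Span : ∀ gs → Span gs ε
  ε∈Span [] = refl
  ε∈Span (g ∷ gs) with Fin-power g 0
  ... | j , jᵍ≡ε = j , subst (Span gs) ε≡ε∙jᵍ (ε∈Span gs)
    where ε≡ε∙jᵍ = trans (sym (identityˡ ε)) (cong (ε ∙_) (sym jᵍ≡ε))

  Span-∙-closed : ∀ gs {x y} → Span gs x → Span gs y → Span gs (x ∙ y)
  Span-∙-closed [] refl refl = identityˡ ε
  Span-∙-closed (g ∷ gs) {x} {y} (i , x∙iᵍ∈) (j , y∙jᵍ∈) with Fin-power g (toℕ i + toℕ j)
  ... | k , kᵍ≡ = k , subst (Span gs) (begin
    (x ∙ toℕ i · g) ∙ (y ∙ toℕ j · g)   ≡⟨ interchange x _ y _ ⟩
    (x ∙ y) ∙ (toℕ i · g ∙ toℕ j · g)   ≡⟨ cong ((x ∙ y) ∙_) (×-homo-+ g (toℕ i) (toℕ j)) ⟨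
    (x ∙ y) ∙ (toℕ i + toℕ j) · g       ≡⟨ cong ((x ∙ y) ∙_) kᵍ≡ ⟨
    (x ∙ y) ∙ toℕ k · g                 ∎) (Span-∙-closed gs x∙iᵍ∈ y∙jᵍ∈)
    where open ≡-Reasoning

  Span-⁻¹-closed : ∀ gs {x} → Span gs x → Span gs (x ⁻¹)
  Span-⁻¹-closed [] refl = ε⁻¹≈ε
  Span-⁻¹-closed (g ∷ gs) {x} (i , x∙iᵍ∈) with Fin-power-⁻¹ g (toℕ i)
  ... | k , kᵍ≡ = k , subst (Span gs) (begin
    (x ∙ toℕ i · g) ⁻¹         ≡⟨ ⁻¹-∙-comm x _ ⟨
    x ⁻¹ ∙ (toℕ i · g) ⁻¹      ≡⟨ cong (x ⁻¹ ∙_) kᵍ≡ ⟨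
    x ⁻¹ ∙ toℕ k · g           ∎) (Span-⁻¹-closed gs x∙iᵍ∈)
    where open ≡-Reasoning

  Span-isSubgroup : ∀ gs → IsSubgroup (Span gs)
  Span-isSubgroup gs = record { ∙-closed = Span-∙-closed gs ; ⁻¹-closed = Span-⁻¹-closed gs }

  Span-⊆ : ∀ {g gs} → Span gs ⊆ Span (g ∷ gs)
  Span-⊆ {g} {gs} {x} x∈ with Fin-power g 0
  ... | j , jᵍ≡ε = j , subst (Span gs) (trans (sym (identityʳ x)) (cong (x ∙_) (sym jᵍ≡ε))) x∈

  ∈Span-∷ : ∀ g gs → Span (g ∷ gs) g
  ∈Span-∷ g gs with Fin-power-⁻¹ g 1
  ... | j , jᵍ≡ = j , subst (Span gs) (begin
    ε                  ≡⟨ inverseʳ g ⟨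
    g ∙ g ⁻¹           ≡⟨ cong (λ z → g ∙ z ⁻¹) (identityʳ g) ⟨
    g ∙ (g ∙ ε) ⁻¹     ≡⟨ cong (g ∙_) jᵍ≡ ⟨
    g ∙ toℕ j · g      ∎) (ε∈Span gs)
    where open ≡-Reasoning

  Span-doubling : ∀ {g gs} → ¬ Span gs g → 2 * count (Span? gs) ≤ count (Span? (g ∷ gs))
  Span-doubling {g} {gs} g∉ = begin
    2 * count (Span? gs)                   ≡⟨ cong (count (Span? gs) +_) (+-identityʳ _) ⟩
    count (Span? gs) + count (Span? gs)    ≤⟨ +-mono-≤ inside outside ⟩
    count (Span? (g ∷ gs) ∩? Span? gs) + count (Span? (g ∷ gs) ∩? ∁? (Span? gs))
                                           ≡⟨ count-split (Span? (g ∷ gs)) (Span? gs) ⟨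
    count (Span? (g ∷ gs))                 ∎
    where
    open ≤-Reasoning
    open IsSubgroup
    inside = count-mono (Span? gs) (Span? (g ∷ gs) ∩? Span? gs) λ x∈ → Span-⊆ x∈ , x∈
    outside = count-translation (Span? gs) (Span? (g ∷ gs) ∩? ∁? (Span? gs)) g
      λ x∈ → ∙-closed (Span-isSubgroup (g ∷ gs)) (∈Span-∷ g gs) (Span-⊆ x∈) ,
             ∉-∙-∈ (Span-isSubgroup gs) g∉ x∈

  Generates : List (Fin n) → Set
  Generates gs = ∀ x → Span gs x

  small-generating-set : ∃ λ gs → 2 ^ length gs ≤ n × Generates gs
  small-generating-set = extend n [] (count>0 (Span? []) refl) refl
    where
    extend : ∀ fuel gs → 2 ^ length gs ≤ count (Span? gs) → length gs + fuel ≡ n →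
      ∃ λ gs → 2 ^ length gs ≤ n × Generates gs
    extend fuel gs 2^k≤#gs _ with all? (Span? gs)
    ... | yes gs-generates = gs , ≤-trans 2^k≤#gs (count-≤ (Span? gs)) , gs-generates
    extend zero gs 2^k≤#gs k+0≡n | no _ =
      contradiction (≤-trans 2^k≤#gs (count-≤ (Span? gs)))
        (<⇒≱ (subst (_< 2 ^ length gs) k≡n (n<2^n (length gs))))
      where k≡n = trans (sym (+-identityʳ _)) k+0≡n
    extend (suc fuel) gs 2^k≤#gs k+fuel≡n | no ¬gs-generates with ¬∀⟶∃¬ n (Span gs) (Span? gs) ¬gs-generates
    ... | g , g∉ = extend fuel (g ∷ gs) (≤-trans (*-monoʳ-≤ 2 2^k≤#gs) (Span-doubling g∉))
                     (trans (sym (+-suc (length gs) fuel)) k+fuel≡n)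

  module _ {φ ψ : Fin n → Fin n} (φ-∙ : IsEndomorphism φ) (ψ-∙ : IsEndomorphism ψ) where

    endomorphisms-agree-on-Span : ∀ gs → (∀ {g} → g ∈ gs → φ g ≡ ψ g) → ∀ {x} → Span gs x → φ x ≡ ψ x
    endomorphisms-agree-on-Span [] _ refl = trans (Endomorphism.φ-ε φ-∙) (sym (Endomorphism.φ-ε ψ-∙))
    endomorphisms-agree-on-Span (g ∷ gs) φ≗ψ {x} (j , x∙jᵍ∈) =
      ∙-cancelʳ (toℕ j · ψ g) (φ x) (ψ x) (begin
        φ x ∙ toℕ j · ψ g       ≡⟨ cong (λ z → φ x ∙ toℕ j · z) (φ≗ψ (here refl)) ⟨
        φ x ∙ toℕ j · φ g       ≡⟨ cong (φ x ∙_) (Endomorphism.φ-· φ-∙ (toℕ j) g) ⟨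
        φ x ∙ φ (toℕ j · g)     ≡⟨ φ-∙ x _ ⟨
        φ (x ∙ toℕ j · g)       ≡⟨ endomorphisms-agree-on-Span gs (φ≗ψ ∘ there) x∙jᵍ∈ ⟩
        ψ (x ∙ toℕ j · g)       ≡⟨ ψ-∙ x _ ⟩
        ψ x ∙ ψ (toℕ j · g)     ≡⟨ cong (ψ x ∙_) (Endomorphism.φ-· ψ-∙ (toℕ j) g) ⟩
        ψ x ∙ toℕ j · ψ g       ∎)
      where open ≡-Reasoning

module Minima {n : ℕ} (A : FinAbGroup n) (φ : Fin n → Fin n) where

  open FinAbGroupProperties A

  Step : Fin n → Fin n → Set
  Step y x = y ≡ x ⁻¹ ⊎ y ≡ φ x ⊎ y ≡ φ x ⁻¹

  Adjacent : Fin n → Fin n → Set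
  Adjacent y x = Step y x ⊎ Step x y

  Adjacent? : ∀ y x → Dec (Adjacent y x)
  Adjacent? y x = step? y x ⊎-dec step? x y
    where step? = λ y x → y ≟ x ⁻¹ ⊎-dec y ≟ φ x ⊎-dec y ≟ φ x ⁻¹

  Minimal : Pred (Fin n) 0ℓ
  Minimal x = ∄[ y ] (Adjacent y x × y Fin.< x)

  Minimal? : Decidable Minimal
  Minimal? x = ¬? (any? λ y → Adjacent? y x ×-dec y Fin.<? x)

  step-from-minimal : ∀ {x y} → Minimal x → Step y x → y ≢ x → ¬ Minimal y
  step-from-minimal {x} {y} x-minimal y-step-x y≢x y-minimal with <-cmp y x
  ... | tri< y<x _ _ = x-minimal (y , inj₁ y-step-x , y<x)
  ... | tri≈ _ y≡x _ = y≢x y≡x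
  ... | tri> _ _ x<y = y-minimal (x , inj₂ y-step-x , x<y)

  StepInvariant : {B : Set} → (Fin n → B) → Set
  StepInvariant f = ∀ {x y} → Step y x → f y ≡ f x

  agree-on-minima⇒≗ : {B : Set} {f g : Fin n → B} → StepInvariant f → StepInvariant g →
    (∀ {x} → Minimal x → f x ≡ g x) → ∀ x → f x ≡ g x
  agree-on-minima⇒≗ {f = f} {g} f-inv g-inv agree = WellFounded.All.wfRec <-wellFounded 0ℓ (λ x → f x ≡ g x) step
    where
    adjacent-invariant : ∀ {h : Fin n → _} → StepInvariant h → ∀ {x y} → Adjacent y x → h y ≡ h x
    adjacent-invariant h-inv = [ h-inv , sym ∘ h-inv ]
    step : ∀ x → (∀ {y} → y Fin.< x → f y ≡ g y) → f x ≡ g x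
    step x ih with any? (λ y → Adjacent? y x ×-dec y Fin.<? x)
    ... | no x-minimal = agree x-minimal
    ... | yes (y , y~x , y<x) = trans (sym (adjacent-invariant f-inv y~x)) (trans (ih y<x) (adjacent-invariant g-inv y~x))

  module Bound (φ-∙ : IsEndomorphism φ) (φ-injective : Injective _≡_ _≡_ φ) where

    open Endomorphism φ-∙
    open IsSubgroup

    Fixed : Pred (Fin n) 0ℓ
    Fixed x = φ x ≡ x

    Inverted : Pred (Fin n) 0ℓ
    Inverted x = φ x ≡ x ⁻¹

    Fixed-isSubgroup : IsSubgroup Fixed
    Fixed-isSubgroup = record
      { ∙-closed = λ {x} {y} φx≡x φy≡y → trans (φ-∙ x y) (cong₂ _∙_ φx≡x φy≡y)
      ; ⁻¹-closed = λ {x} φx≡x → trans (φ-⁻¹ x) (cong _⁻¹ φx≡x)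
      }

    Inverted-isSubgroup : IsSubgroup Inverted
    Inverted-isSubgroup = record
      { ∙-closed = λ {x} {y} φx≡x⁻¹ φy≡y⁻¹ →
          trans (φ-∙ x y) (trans (cong₂ _∙_ φx≡x⁻¹ φy≡y⁻¹) (⁻¹-∙-comm x y))
      ; ⁻¹-closed = λ {x} φx≡x⁻¹ → trans (φ-⁻¹ x) (cong _⁻¹ φx≡x⁻¹)
      }

    Generic : Pred (Fin n) 0ℓ
    Generic = ∁ Fixed ∩ ∁ Inverted

    Fixed? : Decidable Fixed
    Fixed? x = φ x ≟ x

    Inverted? : Decidable Inverted
    Inverted? x = φ x ≟ x ⁻¹

    Generic? : Decidable Generic
    Generic? = ∁? Fixed? ∩? ∁? Inverted?

    φ-Order≤2 : ∀ {x} → Order≤2 x → Order≤2 (φ x)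
    φ-Order≤2 {x} x²≡ε = trans (sym (φ-∙ x x)) (trans (cong φ x²≡ε) φ-ε)

    φ-Order>2 : ∀ {x} → ¬ Order≤2 x → ¬ Order≤2 (φ x)
    φ-Order>2 {x} x²≢ε φx²≡ε = x²≢ε (φ-injective (trans (φ-∙ x x) (trans φx²≡ε (sym φ-ε))))

    φ-Generic : ∀ {x} → Generic x → Generic (φ x)
    φ-Generic {x} (φx≢x , φx≢x⁻¹) =
      φx≢x ∘ φ-injective , λ φφx≡φx⁻¹ → φx≢x⁻¹ (φ-injective (trans φφx≡φx⁻¹ (sym (φ-⁻¹ x))))

    ⁻¹-Generic : ∀ {x} → Generic x → Generic (x ⁻¹)
    ⁻¹-Generic (x∉Fixed , x∉Inverted) = ⁻¹-∉ Fixed-isSubgroup x∉Fixed , ⁻¹-∉ Inverted-isSubgroup x∉Inverted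

    MinimalInverse : Pred (Fin n) 0ℓ
    MinimalInverse x = Minimal (x ⁻¹)

    MinimalInverse? : Decidable MinimalInverse
    MinimalInverse? x = Minimal? (x ⁻¹)

    ⁻¹-not-minimal : ∀ {x} → Minimal x → ¬ Order≤2 x → ¬ Minimal (x ⁻¹)
    ⁻¹-not-minimal {x} x-minimal x²≢ε = step-from-minimal x-minimal (inj₁ refl)
      λ x⁻¹≡x → x²≢ε (trans (cong (x ∙_) (sym x⁻¹≡x)) (inverseʳ x))

    φ-not-minimal : ∀ {x} → Minimal x → Generic x → ¬ Minimal (φ x)
    φ-not-minimal x-minimal (φx≢x , _) = step-from-minimal x-minimal (inj₂ (inj₁ refl)) φx≢x

    φ⁻¹-not-minimal : ∀ {x} → Minimal x → Generic x → ¬ Minimal (φ x ⁻¹)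
    φ⁻¹-not-minimal {x} x-minimal (_ , φx≢x⁻¹) = step-from-minimal x-minimal (inj₂ (inj₂ refl))
      λ φx⁻¹≡x → φx≢x⁻¹ (trans (sym (⁻¹-involutive (φ x))) (cong _⁻¹ φx⁻¹≡x))

    count-Order≤2-bound : 2 * count (Minimal? ∩? Order≤2?) + count (Generic? ∩? Order≤2?) ≤ 2 * count Order≤2?
    count-Order≤2-bound = begin
      2 * x + count (Generic? ∩? Order≤2?)  ≤⟨ +-monoʳ-≤ (2 * x) generic≤2b ⟩
      2 * x + 2 * b                          ≡⟨ *-distribˡ-+ 2 x b ⟨
      2 * (x + b)                            ≤⟨ *-monoʳ-≤ 2 x+b≤m ⟩
      2 * count Order≤2?                     ∎
      where
      open ≤-Reasoning
      x = count (Minimal? ∩? Order≤2?)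
      b = count (Order≤2? ∩? ∁? Minimal? ∩? Generic?)
      x+b≤m : x + b ≤ count Order≤2?
      x+b≤m = begin
        x + b                                                  ≤⟨ +-mono-≤
            (count-mono (Minimal? ∩? Order≤2?) (Order≤2? ∩? Minimal?) swap)
            (count-mono (Order≤2? ∩? ∁? Minimal? ∩? Generic?) (Order≤2? ∩? ∁? Minimal?)
              λ (x²≡ε , x∉M , _) → x²≡ε , x∉M) ⟩
        count (Order≤2? ∩? Minimal?) + count (Order≤2? ∩? ∁? Minimal?)  ≡⟨ count-split Order≤2? Minimal? ⟨
        count Order≤2?                                         ∎
      generic≤2b : count (Generic? ∩? Order≤2?) ≤ 2 * b
      generic≤2b = begin
        count (Generic? ∩? Order≤2?)             ≡⟨ count-split (Generic? ∩? Order≤2?) Minimal? ⟩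
        count ((Generic? ∩? Order≤2?) ∩? Minimal?) + count ((Generic? ∩? Order≤2?) ∩? ∁? Minimal?)
          ≤⟨ +-mono-≤
              (count-injection ((Generic? ∩? Order≤2?) ∩? Minimal?) (Order≤2? ∩? ∁? Minimal? ∩? Generic?) φ φ-injective
                λ ((x-generic , x²≡ε) , x-minimal) →
                  φ-Order≤2 x²≡ε , φ-not-minimal x-minimal x-generic , φ-Generic x-generic)
              (count-mono ((Generic? ∩? Order≤2?) ∩? ∁? Minimal?) (Order≤2? ∩? ∁? Minimal? ∩? Generic?)
                λ ((x-generic , x²≡ε) , x∉M) → x²≡ε , x∉M , x-generic) ⟩
        b + b                                    ≡⟨ cong (b +_) (+-identityʳ b) ⟨
        2 * b                                    ∎

    count-Order>2-bound : 6 * count (Minimal? ∩? Order>2?) + count (Generic? ∩? Order>2?) ≤ 3 * count Order>2?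
    count-Order>2-bound = begin
      6 * y + count (Generic? ∩? Order>2?)  ≤⟨ +-monoʳ-≤ (6 * y) generic≤3q ⟩
      6 * y + 3 * q                          ≡⟨ regroup y q ⟩
      3 * (y + (y + q))                      ≤⟨ *-monoʳ-≤ 3 y+y+q≤l ⟩
      3 * count Order>2?                     ∎
      where
      open ≤-Reasoning
      y = count (Minimal? ∩? Order>2?)
      q = count (Order>2? ∩? ∁? Minimal? ∩? ∁? MinimalInverse?)
      regroup : ∀ y q → 6 * y + 3 * q ≡ 3 * (y + (y + q))
      regroup = solve-∀
      y+y+q≤l : y + (y + q) ≤ count Order>2?
      y+y+q≤l = begin
        y + (y + q)
          ≤⟨ +-mono-≤ (count-mono (Minimal? ∩? Order>2?) (Order>2? ∩? Minimal?) swap) (+-mono-≤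
              (count-injection (Minimal? ∩? Order>2?) ((Order>2? ∩? ∁? Minimal?) ∩? MinimalInverse?) _⁻¹ ⁻¹-injective
                λ {x} (x-minimal , x²≢ε) → (⁻¹-∉ Order≤2-isSubgroup x²≢ε , ⁻¹-not-minimal x-minimal x²≢ε) ,
                                             subst Minimal (sym (⁻¹-involutive x)) x-minimal)
              (count-mono (Order>2? ∩? ∁? Minimal? ∩? ∁? MinimalInverse?)
                          ((Order>2? ∩? ∁? Minimal?) ∩? ∁? MinimalInverse?)
                λ (x²≢ε , x∉M , x⁻¹∉M) → (x²≢ε , x∉M) , x⁻¹∉M)) ⟩
        count (Order>2? ∩? Minimal?) + (count ((Order>2? ∩? ∁? Minimal?) ∩? MinimalInverse?)
          + count ((Order>2? ∩? ∁? Minimal?) ∩? ∁? MinimalInverse?))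
          ≡⟨ cong (count (Order>2? ∩? Minimal?) +_) (count-split (Order>2? ∩? ∁? Minimal?) MinimalInverse?) ⟨
        count (Order>2? ∩? Minimal?) + count (Order>2? ∩? ∁? Minimal?)  ≡⟨ count-split Order>2? Minimal? ⟨
        count Order>2?                                                  ∎
      generic≤3q : count (Generic? ∩? Order>2?) ≤ 3 * q
      generic≤3q = begin
        count (Generic? ∩? Order>2?)
          ≡⟨ count-split (Generic? ∩? Order>2?) Minimal? ⟩
        count (G∩L? ∩? Minimal?) + count (G∩L? ∩? ∁? Minimal?)
          ≡⟨ cong (count (G∩L? ∩? Minimal?) +_) (count-split (G∩L? ∩? ∁? Minimal?) MinimalInverse?) ⟩
        count (G∩L? ∩? Minimal?) + (count ((G∩L? ∩? ∁? Minimal?) ∩? MinimalInverse?)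
                                   + count ((G∩L? ∩? ∁? Minimal?) ∩? ∁? MinimalInverse?))
          ≤⟨ +-mono-≤ minimal≤q (+-mono-≤ (≤-trans inverse-minimal≤minimal minimal≤q)
              (count-mono ((G∩L? ∩? ∁? Minimal?) ∩? ∁? MinimalInverse?)
                          (Order>2? ∩? ∁? Minimal? ∩? ∁? MinimalInverse?)
                λ (((_ , x²≢ε) , x∉M) , x⁻¹∉M) → x²≢ε , x∉M , x⁻¹∉M)) ⟩
        q + (q + q)                              ≡⟨ regroup′ q ⟩
        3 * q                                    ∎
        where
        G∩L? = Generic? ∩? Order>2?
        regroup′ : ∀ q → q + (q + q) ≡ 3 * q
        regroup′ = solve-∀
        minimal≤q : count (G∩L? ∩? Minimal?) ≤ q
        minimal≤q = count-injection (G∩L? ∩? Minimal?) (Order>2? ∩? ∁? Minimal? ∩? ∁? MinimalInverse?) φ φ-injective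
          λ ((x-generic , x²≢ε) , x-minimal) →
            φ-Order>2 x²≢ε , φ-not-minimal x-minimal x-generic , φ⁻¹-not-minimal x-minimal x-generic
        inverse-minimal≤minimal : count ((G∩L? ∩? ∁? Minimal?) ∩? MinimalInverse?) ≤ count (G∩L? ∩? Minimal?)
        inverse-minimal≤minimal =
          count-injection ((G∩L? ∩? ∁? Minimal?) ∩? MinimalInverse?) (G∩L? ∩? Minimal?) _⁻¹ ⁻¹-injective
            λ (((x-generic , x²≢ε) , _) , x⁻¹-minimal) →
              (⁻¹-Generic x-generic , ⁻¹-∉ Order≤2-isSubgroup x²≢ε) , x⁻¹-minimal

    24*count-Minimal≤ : ∀ {g h} → φ g ≢ g → φ h ≢ h ⁻¹ → 24 * count Minimal? ≤ 12 * count Order≤2? + 11 * n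
    24*count-Minimal≤ φg≢g φh≢h⁻¹ = begin
      24 * count Minimal?   ≡⟨ cong (24 *_) (count-split Minimal? Order≤2?) ⟩
      24 * (x + y)          ≤⟨ minima-arithmetic {x} {y} {m} {l} {n} {gₘ} {gₗ}
                                 count-Order≤2-bound count-Order>2-bound (count-complement Order≤2?) n≤4*generic ⟩
      12 * m + 11 * n       ∎
      where
      open ≤-Reasoning
      x = count (Minimal? ∩? Order≤2?)
      y = count (Minimal? ∩? Order>2?)
      m = count Order≤2?
      l = count Order>2?
      gₘ = count (Generic? ∩? Order≤2?)
      gₗ = count (Generic? ∩? Order>2?)
      n≤4*generic : n ≤ 4 * (gₘ + gₗ)
      n≤4*generic = subst (λ c → n ≤ 4 * c) (count-split Generic? Order≤2?)
        (n≤4*count-outside Fixed? Inverted? Fixed-isSubgroup Inverted-isSubgroup φg≢g φh≢h⁻¹)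

module Encoding {n : ℕ} (A : FinAbGroup n) where

  open FinAbGroupProperties A
  open Minima A using (Step; Minimal; Minimal?; StepInvariant; agree-on-minima⇒≗; module Bound)

  Step-cong : ∀ {φ ψ} → φ ≗ ψ → ∀ {x y} → Step φ y x → Step ψ y x
  Step-cong φ≗ψ (inj₁ y≡x⁻¹) = inj₁ y≡x⁻¹
  Step-cong φ≗ψ (inj₂ (inj₁ y≡φx)) = inj₂ (inj₁ (trans y≡φx (φ≗ψ _)))
  Step-cong φ≗ψ (inj₂ (inj₂ y≡φx⁻¹)) = inj₂ (inj₂ (trans y≡φx⁻¹ (cong _⁻¹ (φ≗ψ _))))

  Minimal-cong : ∀ {φ ψ} → φ ≗ ψ → ∀ {x} → Minimal φ x → Minimal ψ x
  Minimal-cong φ≗ψ x-minimal (y , y~x , y<x) = x-minimal (y , map-⊎ step step y~x , y<x)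
    where step = Step-cong (sym ∘ φ≗ψ)

  record SymmetryWitness (S : Subset n) : Set where
    field
      φ : Fin n → Fin n
      φ-∙ : IsEndomorphism φ
      φ-injective : Injective _≡_ _≡_ φ
      g h : Fin n
      φg≢g : φ g ≢ g
      φh≢h⁻¹ : φ h ≢ h ⁻¹
      ⁻¹-invariant : ∀ x → lookup S (x ⁻¹) ≡ lookup S x
      φ-invariant : ∀ x → lookup S (φ x) ≡ lookup S x

    step-invariant : ∀ {ψ} → ψ ≗ φ → StepInvariant ψ (lookup S)
    step-invariant ψ≗φ step with Step-cong ψ≗φ step
    ... | inj₁ refl = ⁻¹-invariant _
    ... | inj₂ (inj₁ refl) = φ-invariant _
    ... | inj₂ (inj₂ refl) = trans (⁻¹-invariant _) (φ-invariant _)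

  symmetryWitness : ∀ {S} → Counted A S → SymmetryWitness S
  symmetryWitness {S} (⁻¹-closed , φ , (((φ-injective , _) , φ-∙) , φ≢id , φ≢ι) , φ[S]≡S) = record
    { φ = φ ; φ-∙ = φ-∙ ; φ-injective = φ-injective
    ; φg≢g = proj₂ (¬∀⟶∃¬ n _ (λ x → φ x ≟ x) φ≢id)
    ; φh≢h⁻¹ = proj₂ (¬∀⟶∃¬ n _ (λ x → φ x ≟ x ⁻¹) φ≢ι)
    ; ⁻¹-invariant = λ x → ⇔⇒lookup-≡
        (λ x⁻¹∈S → subst (_∈ₛ S) (⁻¹-involutive x) (⁻¹-closed _ x⁻¹∈S))
        (⁻¹-closed x)
    ; φ-invariant = λ x → ⇔⇒lookup-≡
        (λ φx∈S → let (x′ , x′∈S , φx′≡φx) = proj₁ (φ[S]≡S (φ x)) φx∈S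
                   in subst (_∈ₛ S) (φ-injective φx′≡φx) x′∈S)
        (λ x∈S → proj₂ (φ[S]≡S (φ x)) (x , x∈S , refl))
    }

  generators : List (Fin n)
  generators = proj₁ small-generating-set

  k : ℕ
  k = length generators

  r : ℕ
  r = (12 * numOrderLE2 A + 11 * n) / 24

  module _ {S : Subset n} (w : SymmetryWitness S) where

    open SymmetryWitness w

    minima : List (Fin n)
    minima = filter (Minimal? φ) (allFin n)

    length-minima≤r : length minima ≤ r
    length-minima≤r = begin
      length minima               ≡⟨ m*n/n≡m (length minima) 24 ⟨
      length minima * 24 / 24     ≤⟨ /-monoˡ-≤ {length minima * 24} 24 24*minima≤ ⟩
      r                           ∎
      where
      open ≤-Reasoning
      24*minima≤ : length minima * 24 ≤ 12 * numOrderLE2 A + 11 * n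
      24*minima≤ = subst (_≤ 12 * numOrderLE2 A + 11 * n) (*-comm 24 (length minima))
        (Bound.24*count-Minimal≤ φ φ-∙ φ-injective φg≢g φh≢h⁻¹)

    generator-images : Fin (n ^ k)
    generator-images = funToFin (φ ∘ List.lookup generators)

    minima-bits : Fin (2 ^ r)
    minima-bits = funToFin λ (i : Fin r) → Inverse.from 2↔Bool (lookup S (lookupOr ε minima (toℕ i)))

    code : Fin (n ^ k * 2 ^ r)
    code = combine generator-images minima-bits

  code-injective : ∀ {S S′} (w : SymmetryWitness S) (w′ : SymmetryWitness S′) → code w ≡ code w′ → S ≡ S′
  code-injective {S} {S′} w w′ code≡ = begin
    S                   ≡⟨ tabulate∘lookup S ⟨
    tabulate (lookup S) ≡⟨ tabulate-cong (agree-on-minima⇒≗ W.φ (W.step-invariant (λ _ → refl))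
                                             (W′.step-invariant φ≗φ′) S≗S′-on-minima) ⟩
    tabulate (lookup S′) ≡⟨ tabulate∘lookup S′ ⟩
    S′                  ∎
    where
    open ≡-Reasoning
    module W = SymmetryWitness w
    module W′ = SymmetryWitness w′
    parts≡ = combine-injective (generator-images w) (minima-bits w) (generator-images w′) (minima-bits w′) code≡
    φ≗φ′ : W.φ ≗ W′.φ
    φ≗φ′ x = endomorphisms-agree-on-Span W.φ-∙ W′.φ-∙ generators
      (λ g∈gs → subst (λ g → W.φ g ≡ W′.φ g) (sym (lookup-index g∈gs))
                  (funToFin-injective (proj₁ parts≡) (index g∈gs)))
      (proj₂ (proj₂ small-generating-set) x)
    minima≡ : minima w′ ≡ minima w
    minima≡ = filter-≐ (Minimal? W′.φ) (Minimal? W.φ)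
      (Minimal-cong (sym ∘ φ≗φ′) , Minimal-cong φ≗φ′) (allFin n)
    S≗S′-on-minima : ∀ {x} → Minimal W.φ x → lookup S x ≡ lookup S′ x
    S≗S′-on-minima {x} x-minimal = begin
      lookup S x                                  ≡⟨ cong (lookup S) i-th-minimum ⟨
      lookup S (lookupOr ε (minima w) (toℕ i))    ≡⟨ 2↔Bool-from-injective (funToFin-injective (proj₂ parts≡) i) ⟩
      lookup S′ (lookupOr ε (minima w′) (toℕ i))  ≡⟨ cong (lookup S′) i-th-minimum′ ⟩
      lookup S′ x                                 ∎
      where
      x∈minima = ∈-filter⁺ (Minimal? W.φ) (∈-allFin x) x-minimal
      i<r = ≤-trans (toℕ<n (index x∈minima)) (length-minima≤r w)
      i = fromℕ< i<r
      i-th-minimum : lookupOr ε (minima w) (toℕ i) ≡ x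
      i-th-minimum = trans (cong (lookupOr ε (minima w)) (toℕ-fromℕ< i<r)) (lookupOr-index x∈minima)
      i-th-minimum′ : lookupOr ε (minima w′) (toℕ i) ≡ x
      i-th-minimum′ = trans (cong (λ xs → lookupOr ε xs (toℕ i)) minima≡) i-th-minimum

  length≤n^k*2^r : ∀ {Ss} → Unique Ss → All (Counted A) Ss → length Ss ≤ n ^ k * 2 ^ r
  length≤n^k*2^r {Ss} Ss-unique Ss-counted = subst (length Ss ≤_) (length-tabulate id)
    (length-≤-of-injection (allFin _) Ss-unique (code ∘ witness) (λ _ → ∈-allFin _)
      (λ S∈Ss S′∈Ss → code-injective (witness S∈Ss) (witness S′∈Ss)))
    where
    witness : ∀ {S} → S ∈ Ss → SymmetryWitness S
    witness = symmetryWitness ∘ All.lookup Ss-counted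

  2^k≤n : 2 ^ k ≤ n
  2^k≤n = proj₁ (proj₂ small-generating-set)

  24*r≤12m+11n : 24 * r ≤ 12 * numOrderLE2 A + 11 * n
  24*r≤12m+11n = subst (_≤ 12 * numOrderLE2 A + 11 * n) (*-comm r 24) (m/n*n≤m (12 * numOrderLE2 A + 11 * n) 24)


lemma5p5 : (n : ℕ) (A : FinAbGroup n) → ExponentGT2 A →
    (Ss : List (Subset n)) → Unique Ss → All (Counted A) Ss →
    BoundedBy (length Ss) (numOrderLE2 A) n
lemma5p5 n A _ Ss Ss-unique Ss-counted =
  ≤n^k*2^r⇒BoundedBy {m = numOrderLE2 A} {k = k} {r = r} (length≤n^k*2^r Ss-unique Ss-counted) 2^k≤n 24*r≤12m+11n
  where open Encoding A
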